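{- Let $G$ be a finite simple graph on $n$ vertices with minimum degree $\delta$. Then $\gamma_{gr}^L(G) \leq n - \delta + 1$.
   Context: All graphs are finite, simple and undirected. For a vertex $v$, $N(v)$ is its open neighborhood (the set of its neighbors) and $N[v] = N(v) \cup \{v\}$ its closed neighborhood. An L-sequence of $G$ is a sequence $(v_1, \ldots, v_k)$ of distinct vertices of $G$ such that for every $i \in \{1,\ldots,k\}$, $N[v_i] \setminus \bigcup_{j=1}^{i-1} N(v_j) \neq \emptyset$. The L-Grundy domination number $\gamma_{gr}^L(G)$ is the maximum length of an L-sequence of $G$. -}

module Defs where

open import Data.Nat using (ℕ; _≤_)
open import Data.Fin using (Fin)
open import Data.Bool using (Bool; true; false; if_then_else_)
open import Data.List using (List; []; _∷_; length; map; allFin)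
open import Data.Nat.ListAction using (sum)
open import Data.List.Relation.Unary.All using (All)
open import Data.List.Relation.Unary.Unique.Propositional using (Unique)
open import Data.Product using (Σ; _×_; ∃; ∃-syntax)
open import Data.Sum using (_⊎_)
open import Data.Unit using (⊤)
open import Relation.Nullary using (¬_)
open import Relation.Binary.PropositionalEquality using (_≡_)

record Graph (n : ℕ) : Set where
  field
    adj     : Fin n → Fin n → Bool
    sym     : ∀ u v → adj u v ≡ adj v u
    irrefl  : ∀ v → adj v v ≡ false

module _ {n : ℕ} (G : Graph n) where
  open Graph G

  Adj : Fin n → Fin n → Set
  Adj v u = adj v u ≡ true

  InClosedNbhd : Fin n → Fin n → Set
  InClosedNbhd v w = (w ≡ v) ⊎ Adj v w

  degree : Fin n → ℕ
  degree v = sum (map (λ u → if adj v u then 1 else 0) (allFin n))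

  IsMinDegree : ℕ → Set
  IsMinDegree δ = (∀ v → δ ≤ degree v) × (∃[ v ] degree v ≡ δ)

  -- LCond prev vs : every vertex v of vs has a vertex w ∈ N[v] that is not
  -- in N(u) for any u occurring before v (in prev, or earlier in vs).
  -- `prev` holds the already-chosen vertices (in reverse order; only
  -- membership matters).
  LCond : List (Fin n) → List (Fin n) → Set
  LCond prev []       = ⊤
  LCond prev (v ∷ vs) =
    (∃[ w ] (InClosedNbhd v w × All (λ u → ¬ Adj u w) prev))
    × LCond (v ∷ prev) vs

  -- (v₁,…,v_k) is an L-sequence: distinct vertices with
  -- N[vᵢ] ∖ ⋃_{j<i} N(vⱼ) ≠ ∅ for every i.
  IsLSequence : List (Fin n) → Set
  IsLSequence vs = Unique vs × LCond [] vs

  IsLGrundyNumber : ℕ → Set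
  IsLGrundyNumber k =
    (∃[ vs ] (IsLSequence vs × length vs ≡ k))
    × (∀ vs → IsLSequence vs → length vs ≤ k)

{-# OPTIONS --safe #-}
module Submission where

-- The last vertex v of an L-sequence has a witness w ∈ N[v] adjacent to none of
-- the k − 1 earlier vertices. These earlier vertices and N(w) are disjoint sets of
-- vertices, so (k − 1) + deg w ≤ n, and deg w ≥ δ gives k ≤ n − δ + 1.

open import Defs
open import Data.Nat using (ℕ; _≤_; _+_; _∸_; suc; z≤n; s≤s)
open import Data.Nat.Properties using (≤-trans; +-monoˡ-≤; +-monoʳ-≤; m+n≤o⇒m≤o∸n; module ≤-Reasoning)
open import Data.Fin using (Fin)
open import Data.Fin.Properties using (_≟_)
open import Data.Bool using (Bool; true; false; if_then_else_)
import Data.Bool.Properties as Bool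
open import Data.List using (List; []; _∷_; _∷ʳ_; _++_; length; map; filter; allFin; initLast; _∷ʳ′_)
open import Data.List.Properties using (length-++; length-tabulate; filter-notAll)
open import Data.Nat.ListAction using (sum)
open import Data.List.Relation.Unary.All using (All; []; _∷_; lookup)
open import Data.List.Relation.Unary.All.Properties using (++⁻ˡ)
open import Data.List.Relation.Unary.Any as Any using (here; there)
open import Data.List.Relation.Unary.AllPairs using ([]; _∷_)
open import Data.List.Relation.Unary.Unique.Propositional using (Unique)
open import Data.List.Relation.Unary.Unique.Propositional.Properties
  using (++⁺; filter⁺; allFin⁺; Unique[x∷xs]⇒x∉xs)
open import Data.List.Membership.Propositional using (_∈_)
open import Data.List.Membership.Propositional.Properties using (∈-filter⁺; ∈-filter⁻; ∈-allFin)
open import Data.List.Relation.Binary.Subset.Propositional using (_⊆_)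
open import Data.Product using (_×_; _,_; proj₂; ∃-syntax)
open import Relation.Nullary using (¬_; ¬?)
open import Relation.Binary.Definitions using (DecidableEquality)
open import Relation.Binary.PropositionalEquality using (_≡_; refl; sym; trans; cong)

module _ {a} {A : Set a} where

  Unique-++⁻ˡ : ∀ (xs : List A) {ys} → Unique (xs ++ ys) → Unique xs
  Unique-++⁻ˡ []       _          = []
  Unique-++⁻ˡ (x ∷ xs) (x∉ ∷ uxs) = ++⁻ˡ xs x∉ ∷ Unique-++⁻ˡ xs uxs

  sum-indicator≡length-filter : (f : A → Bool) (xs : List A) →
    sum (map (λ x → if f x then 1 else 0) xs) ≡ length (filter (λ x → f x Bool.≟ true) xs)
  sum-indicator≡length-filter f []       = refl
  sum-indicator≡length-filter f (x ∷ xs) with f x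
  ... | true  = cong suc (sum-indicator≡length-filter f xs)
  ... | false = sum-indicator≡length-filter f xs

  Unique⇒length≤ : DecidableEquality A → ∀ {xs ys : List A} →
    Unique xs → xs ⊆ ys → length xs ≤ length ys
  Unique⇒length≤ _≟ₐ_ {[]}     _          _     = z≤n
  Unique⇒length≤ _≟ₐ_ {x ∷ xs} {ys} (x∉ ∷ uxs) xs⊆ys =
    ≤-trans (s≤s (Unique⇒length≤ _≟ₐ_ uxs xs⊆ys-x))
            (filter-notAll ≢x? ys (Any.map (λ x≡y ¬y≡x → ¬y≡x (sym x≡y)) (xs⊆ys (here refl))))
    where
      ≢x? = λ y → ¬? (y ≟ₐ x)
      xs⊆ys-x : xs ⊆ filter ≢x? ys
      xs⊆ys-x y∈xs = ∈-filter⁺ ≢x? (xs⊆ys (there y∈xs))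
                       (λ { refl → Unique[x∷xs]⇒x∉xs (x∉ ∷ uxs) y∈xs })

Unique⇒length≤n : ∀ {n} {vs : List (Fin n)} → Unique vs → length vs ≤ n
Unique⇒length≤n {n} uvs = begin
  _                  ≤⟨ Unique⇒length≤ _≟_ uvs (λ _ → ∈-allFin _) ⟩
  length (allFin n)  ≡⟨ length-tabulate (λ i → i) ⟩
  n                  ∎
  where open ≤-Reasoning

module _ {n : ℕ} (G : Graph n) where
  open Graph G using (adj) renaming (sym to adj-sym)

  neighbours : Fin n → List (Fin n)
  neighbours w = filter (λ u → adj w u Bool.≟ true) (allFin n)

  degree≡length-neighbours : ∀ w → degree G w ≡ length (neighbours w)
  degree≡length-neighbours w = sum-indicator≡length-filter (adj w) (allFin n)

  ∈-neighbours⇒Adj : ∀ {w u} → u ∈ neighbours w → Adj G u w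
  ∈-neighbours⇒Adj {w} {u} u∈ =
    trans (adj-sym u w) (proj₂ (∈-filter⁻ (λ u → adj w u Bool.≟ true) {xs = allFin n} u∈))

  length+degree≤n : ∀ {w} {us : List (Fin n)} → Unique us →
    All (λ u → ¬ Adj G u w) us → length us + degree G w ≤ n
  length+degree≤n {w} {us} uus us≁w = begin
    length us + degree G w               ≡⟨ cong (length us +_) (degree≡length-neighbours w) ⟩
    length us + length (neighbours w)    ≡⟨ sym (length-++ us) ⟩
    length (us ++ neighbours w)          ≤⟨ Unique⇒length≤n (++⁺ uus (filter⁺ _ (allFin⁺ n)) disjoint) ⟩
    n                                    ∎
    where
      open ≤-Reasoning
      disjoint : ∀ {u} → ¬ (u ∈ us × u ∈ neighbours w)
      disjoint (u∈us , u∈N) = lookup us≁w u∈us (∈-neighbours⇒Adj u∈N)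

  LCond-last : ∀ {prev} us v → LCond G prev (us ∷ʳ v) →
    ∃[ w ] (All (λ u → ¬ Adj G u w) prev × All (λ u → ¬ Adj G u w) us)
  LCond-last []       v ((w , _ , prev≁w) , _) = w , prev≁w , []
  LCond-last (u ∷ us) v (_ , rest) with LCond-last us v rest
  ... | w , (u≁w ∷ prev≁w) , us≁w = w , prev≁w , u≁w ∷ us≁w

theorem2p1 : (n : ℕ) (G : Graph n) (δ γ : ℕ) →
    IsMinDegree G δ → IsLGrundyNumber G γ → γ ≤ n ∸ δ + 1
theorem2p1 n G δ γ (δ≤deg , _) ((vs , (uvs , lvs) , refl) , _) with initLast vs
... | []         = z≤n
... | us ∷ʳ′ v   with LCond-last G us v lvs
...   | w , _ , us≁w = begin
  length (us ∷ʳ v)  ≡⟨ length-++ us ⟩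
  length us + 1     ≤⟨ +-monoˡ-≤ 1 (m+n≤o⇒m≤o∸n (length us) us+δ≤n) ⟩
  n ∸ δ + 1         ∎
  where
    open ≤-Reasoning
    us+δ≤n : length us + δ ≤ n
    us+δ≤n = ≤-trans (+-monoʳ-≤ (length us) (δ≤deg w))
                     (length+degree≤n G (Unique-++⁻ˡ us uvs) us≁w)
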